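{- Let $G$ be a $P_4$-sparse graph consisting of exactly two connected components with vertex sets $C_u\ni u$ and $C_v\ni v$. Suppose that an optimal solution $H$ of the ($P_4$-sparse-2CC,$+1$)-MinEdgeAddition Problem for $G$ and the non-edge $uv$ is a thick spider with spider partition $(S,K,R)$, $|S|=|K|\ge3$, and $u,v\in R$. Then it is not possible that $S\cup K$ contains vertices from both $C_u$ and $C_v$.
   Context: All graphs are finite, simple, undirected. A graph is $P_4$-sparse if no five vertices induce more than one $P_4$. A thick spider is a graph whose vertex set has a partition $(S,K,R)$ (spider partition) with $S$ independent, $K$ a clique, $|S|=|K|$ (here $\ge3$), every vertex of $R$ adjacent to all of $K$ and to none of $S$, and a bijection $f:S\to K$ with $N(s)\cap K=K\setminus\{f(s)\}$ for every $s\in S$. ($P_4$-sparse-2CC,$+1$)-MinEdgeAddition Problem: $G$ is $P_4$-sparse with exactly two connected components $C_u\ni u$, $C_v\ni v$; a solution is a $P_4$-sparse $H$ with $V(H)=V(G)$, $E(G)\cup\{uv\}\subseteq E(H)$; fill edges are $E(H)\setminus E(G)$ (including $uv$); optimal solutions minimize their number. -}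

module Defs where

open import Data.Nat using (ℕ; _≤_; _<ᵇ_)
open import Data.Bool using (Bool; true; false; not; _∧_; if_then_else_)
open import Data.Fin using (Fin; toℕ)
open import Data.Fin.Subset using (Subset; _∈_; _∉_; _⊆_; ∣_∣)
open import Data.List using (map; allFin)
open import Data.Nat.ListAction using (sum)
open import Data.Product using (Σ; _×_; ∃; ∃-syntax)
open import Data.Sum using (_⊎_)
open import Relation.Binary.PropositionalEquality using (_≡_; _≢_)
open import Relation.Nullary using (¬_)
open import Function.Bundles using (_⇔_)

record Graph (n : ℕ) : Set where
  field
    adj   : Fin n → Fin n → Bool
    sym   : ∀ x y → adj x y ≡ adj y x
    irrefl : ∀ x → adj x x ≡ false
open Graph public

Edge : ∀ {n} → Graph n → Fin n → Fin n → Set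
Edge G x y = adj G x y ≡ true

NonEdge : ∀ {n} → Graph n → Fin n → Fin n → Set
NonEdge G x y = adj G x y ≡ false

InducesP4 : ∀ {n} → Graph n → Subset n → Set
InducesP4 {n} G A =
  ∣ A ∣ ≡ 4 ×
  Σ (Fin n) λ a → Σ (Fin n) λ b → Σ (Fin n) λ c → Σ (Fin n) λ d →
    (∀ x → (x ∈ A) ⇔ (x ≡ a ⊎ x ≡ b ⊎ x ≡ c ⊎ x ≡ d)) ×
    Edge G a b × Edge G b c × Edge G c d ×
    NonEdge G a c × NonEdge G b d × NonEdge G a d

P4Sparse : ∀ {n} → Graph n → Set
P4Sparse {n} G = ∀ (X A B : Subset n) → ∣ X ∣ ≡ 5 → A ⊆ X → B ⊆ X →
  InducesP4 G A → InducesP4 G B → A ≡ B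

data Reachable {n} (G : Graph n) : Fin n → Fin n → Set where
  here : ∀ {x} → Reachable G x x
  step : ∀ {x y z} → Edge G x y → Reachable G y z → Reachable G x z

TwoComponents : ∀ {n} → Graph n → Fin n → Fin n → Set
TwoComponents G u v = ¬ Reachable G u v × (∀ x → Reachable G u x ⊎ Reachable G v x)

IsSolution : ∀ {n} → Graph n → Fin n → Fin n → Graph n → Set
IsSolution G u v H = P4Sparse H × (∀ x y → Edge G x y → Edge H x y) × Edge H u v

fillCount : ∀ {n} → Graph n → Graph n → ℕ
fillCount {n} G H =
  sum (map (λ i → sum (map (λ j →
     if (toℕ i <ᵇ toℕ j) ∧ adj H i j ∧ not (adj G i j) then 1 else 0)
     (allFin n))) (allFin n))

IsOptimalSolution : ∀ {n} → Graph n → Fin n → Fin n → Graph n → Set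
IsOptimalSolution {n} G u v H =
  IsSolution G u v H × (∀ (H' : Graph n) → IsSolution G u v H' → fillCount G H ≤ fillCount G H')

IsPartition3 : ∀ {n} → Subset n → Subset n → Subset n → Set
IsPartition3 S K R = ∀ x →
  (x ∈ S × x ∉ K × x ∉ R) ⊎ (x ∉ S × x ∈ K × x ∉ R) ⊎ (x ∉ S × x ∉ K × x ∈ R)

IsThickSpiderPartition : ∀ {n} → Graph n → Subset n → Subset n → Subset n → Set
IsThickSpiderPartition {n} H S K R =
  IsPartition3 S K R ×
  (∀ x y → x ∈ S → y ∈ S → NonEdge H x y) ×
  (∀ x y → x ∈ K → y ∈ K → x ≢ y → Edge H x y) ×
  ∣ S ∣ ≡ ∣ K ∣ × 3 ≤ ∣ S ∣ ×
  (∀ r k → r ∈ R → k ∈ K → Edge H r k) ×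
  (∀ r s → r ∈ R → s ∈ S → NonEdge H r s) ×
  Σ (Fin n → Fin n) λ f →
    (∀ s → s ∈ S → f s ∈ K) ×
    (∀ s t → s ∈ S → t ∈ S → f s ≡ f t → s ≡ t) ×
    (∀ k → k ∈ K → ∃[ s ] (s ∈ S × f s ≡ k)) ×
    (∀ s k → s ∈ S → k ∈ K → (Edge H s k ⇔ k ≢ f s))

{-# OPTIONS --safe #-}
-- Making u universal in G gives a solution H′: a universal vertex lies on no induced P4, so
-- H′ is P4-sparse, and its fill edges are the pairs uj with j ≠ u and uj ∉ G. We show that H
-- has strictly more fill edges. Such a j is either joined to u in H, which costs H the fill
-- edge uj, or is a non-neighbour of u in H, hence lies in S ∪ R. Since S ∪ K meets both
-- components, so does K, and every edge of H between the two components is a fill edge.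
-- Each vertex of S ∪ R other than u has such a cross edge into K, except a vertex s ∈ S whose
-- only possible cross partner in K is f s; then two other vertices of K lie across from f s and
-- give two cross edges inside the clique K at f s. As f is injective, charging these edges to
-- the vertices of S ∪ R ∖ {u} pays for every non-neighbour of u, with v ∈ R left over.
module Submission where

open import Defs hiding (sym)
open import Data.Nat.Properties
  using ( +-*-semiring; ≤-refl; ≤-reflexive; ≤-trans; <-≤-trans; <-cmp; _<?_; <⇒≱
        ; n≤1+n; m≤m+n; m≤n+m; m<m+n; +-comm; +-suc; +-identityʳ; *-identityˡ; *-identityʳ
        ; *-assoc; *-distribˡ-+; +-mono-≤; +-monoʳ-≤; +-monoʳ-<; *-monoˡ-≤; *-monoʳ-≤
        ; *-cancelˡ-<; module ≤-Reasoning)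
open import Algebra.Properties.Semiring.Sum +-*-semiring
  using ( sum; sum-syntax; ∑-distrib-+; ∑-comm; *-distribˡ-sum; *-distribʳ-sum
        ; sum-cong-≗; sum-replicate-zero)
open import Data.Bool using (Bool; true; false; not; _∧_; _xor_; if_then_else_)
open import Data.Bool.Properties using (xor-same; ∧-zeroʳ; ∧-inverseʳ)
open import Data.Empty using (⊥)
open import Data.Fin using (Fin; zero; suc; toℕ)
open import Data.Fin.Properties using (_≟_; suc-injective; toℕ-injective)
open import Data.Fin.Subset using (Subset; _∈_; _∉_; ∣_∣; _∪_; ⁅_⁆)
open import Data.Fin.Subset.Properties
  using (_∈?_; drop-there; x∈⁅x⁆; x∈p∪q⁺; ∣⁅x⁆∣≡1)
open import Data.List using (map; allFin; tabulate)
open import Data.List.Properties using (map-tabulate)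
import Data.Nat.ListAction as List
open import Data.Nat using (ℕ; zero; suc; _+_; _*_; _≤_; _<_; _<ᵇ_; z≤n; s≤s)
open import Data.Product using (∃-syntax; _×_; _,_; proj₁; proj₂)
open import Data.Sum using (_⊎_; inj₁; inj₂)
open import Data.Vec using ([]; _∷_; here; there)
open import Function using (id; _∘_)
open import Function.Bundles using (_⇔_; Equivalence)
open import Relation.Binary.Definitions using (tri<; tri≈; tri>)
open import Relation.Binary.PropositionalEquality
open import Relation.Nullary using (Dec; yes; no; does; ¬_; contradiction; _×-dec_)
open import Relation.Nullary.Decidable using (dec-true; dec-false)
open import Relation.Unary using (Pred; Decidable)

private variable
  n : ℕ

-- Finite sums

𝟙 : Bool → ℕ
𝟙 b = if b then 1 else 0

𝟙≤1 : ∀ b → 𝟙 b ≤ 1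
𝟙≤1 true = ≤-refl
𝟙≤1 false = z≤n

𝟙-∧ : ∀ a b → 𝟙 (a ∧ b) ≡ 𝟙 a * 𝟙 b
𝟙-∧ true b = sym (*-identityˡ (𝟙 b))
𝟙-∧ false b = refl

𝟙-∧≤ʳ : ∀ a b → 𝟙 (a ∧ b) ≤ 𝟙 b
𝟙-∧≤ʳ true b = ≤-refl
𝟙-∧≤ʳ false b = z≤n

sum-tabulate : (f : Fin n → ℕ) → List.sum (tabulate f) ≡ sum f
sum-tabulate {zero} f = refl
sum-tabulate {suc n} f = cong (f zero +_) (sum-tabulate (f ∘ suc))

sum-allFin : (f : Fin n → ℕ) → List.sum (map f (allFin n)) ≡ sum f
sum-allFin f = trans (cong List.sum (map-tabulate id f)) (sum-tabulate f)

sum-mono-≤ : {f g : Fin n → ℕ} → (∀ i → f i ≤ g i) → sum f ≤ sum g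
sum-mono-≤ {zero} f≤g = z≤n
sum-mono-≤ {suc n} f≤g = +-mono-≤ (f≤g zero) (sum-mono-≤ (f≤g ∘ suc))

sum-zero : {f : Fin n → ℕ} → (∀ i → f i ≡ 0) → sum f ≡ 0
sum-zero {n} f≡0 = trans (sum-cong-≗ f≡0) (sum-replicate-zero n)

term≤sum : (f : Fin n → ℕ) (i : Fin n) → f i ≤ sum f
term≤sum f zero = m≤m+n (f zero) _
term≤sum f (suc i) = ≤-trans (term≤sum (f ∘ suc) i) (m≤n+m _ (f zero))

two-terms≤sum : (f : Fin n → ℕ) {i j : Fin n} → i ≢ j → f i + f j ≤ sum f
two-terms≤sum f {zero} {zero} i≢j = contradiction refl i≢j
two-terms≤sum f {zero} {suc j} _ = +-monoʳ-≤ (f zero) (term≤sum (f ∘ suc) j)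
two-terms≤sum f {suc i} {zero} _ =
  subst (_≤ sum f) (+-comm (f zero) (f (suc i))) (+-monoʳ-≤ (f zero) (term≤sum (f ∘ suc) i))
two-terms≤sum f {suc i} {suc j} i≢j =
  ≤-trans (two-terms≤sum (f ∘ suc) (i≢j ∘ cong suc)) (m≤n+m _ (f zero))

sum-δ : (g : Fin n → ℕ) (x : Fin n) → ∑[ i < n ] (𝟙 (does (i ≟ x)) * g i) ≡ g x
sum-δ {suc n} g zero =
  trans (cong₂ _+_ (*-identityˡ (g zero)) (sum-zero {n} (λ _ → refl))) (+-identityʳ (g zero))
sum-δ {suc n} g (suc x) = sum-δ (g ∘ suc) x

sum-𝟙-unique≤1 : ∀ {ℓ} {P : Pred (Fin n) ℓ} (P? : Decidable P) →
  (∀ {i j} → P i → P j → i ≡ j) → ∑[ i < n ] 𝟙 (does (P? i)) ≤ 1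
sum-𝟙-unique≤1 {zero} P? unique = z≤n
sum-𝟙-unique≤1 {suc n} P? unique with P? zero
... | yes p₀ = ≤-reflexive (cong suc (sum-zero elsewhere))
  where
  elsewhere : ∀ i → 𝟙 (does (P? (suc i))) ≡ 0
  elsewhere i with P? (suc i)
  ... | yes pᵢ with () ← unique p₀ pᵢ
  ... | no _ = refl
... | no _ = sum-𝟙-unique≤1 (P? ∘ suc) (λ p q → suc-injective (unique p q))

sum-reindex-≤ : ∀ {ℓ} {P : Pred (Fin n) ℓ} (P? : Decidable P) (f : Fin n → Fin n) →
  (g : Fin n → ℕ) → (∀ {i j} → P i → P j → f i ≡ f j → i ≡ j) →
  ∑[ i < n ] (𝟙 (does (P? i)) * g (f i)) ≤ sum g
sum-reindex-≤ {n} {P = P} P? f g injective = begin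
  ∑[ i < n ] (𝟙 (does (P? i)) * g (f i))  ≡⟨ sum-cong-≗ row ⟨
  ∑[ i < n ] ∑[ k < n ] w i k             ≡⟨ ∑-comm w ⟩
  ∑[ k < n ] ∑[ i < n ] w i k             ≤⟨ sum-mono-≤ column ⟩
  sum g                                   ∎
  where
  open ≤-Reasoning
  w : Fin n → Fin n → ℕ
  w i k = 𝟙 (does (P? i)) * (𝟙 (does (k ≟ f i)) * g k)

  row : ∀ i → sum (w i) ≡ 𝟙 (does (P? i)) * g (f i)
  row i = trans (sym (*-distribˡ-sum {n} (𝟙 (does (P? i))) _))
                (cong (𝟙 (does (P? i)) *_) (sum-δ g (f i)))

  preimage? : ∀ k → Decidable (λ i → P i × k ≡ f i)
  preimage? k i = P? i ×-dec (k ≟ f i)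

  unique : ∀ {k i j} → P i × k ≡ f i → P j × k ≡ f j → i ≡ j
  unique (pᵢ , refl) (pⱼ , fi≡fj) = injective pᵢ pⱼ fi≡fj

  column : ∀ k → ∑[ i < n ] w i k ≤ g k
  column k = begin
    ∑[ i < n ] w i k
      ≡⟨ sum-cong-≗ (λ i → sym (*-assoc (𝟙 (does (P? i))) _ (g k))) ⟩
    ∑[ i < n ] (𝟙 (does (P? i)) * 𝟙 (does (k ≟ f i)) * g k)
      ≡⟨ sum-cong-≗ (λ i → cong (_* g k) (sym (𝟙-∧ (does (P? i)) (does (k ≟ f i))))) ⟩
    ∑[ i < n ] (𝟙 (does (preimage? k i)) * g k)
      ≡⟨ *-distribʳ-sum {n} (g k) _ ⟨
    ∑[ i < n ] 𝟙 (does (preimage? k i)) * g k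
      ≤⟨ *-monoˡ-≤ (g k) (sum-𝟙-unique≤1 (preimage? k) unique) ⟩
    1 * g k
      ≡⟨ *-identityˡ (g k) ⟩
    g k ∎

∑∑ : (Fin n → Fin n → ℕ) → ℕ
∑∑ {n} b = ∑[ i < n ] ∑[ j < n ] b i j

∑∑-mono-≤ : {a b : Fin n → Fin n → ℕ} → (∀ i j → a i j ≤ b i j) → ∑∑ a ≤ ∑∑ b
∑∑-mono-≤ a≤b = sum-mono-≤ (λ i → sum-mono-≤ (a≤b i))

∑∑-distrib-+ : (a b : Fin n → Fin n → ℕ) →
  ∑∑ (λ i j → a i j + b i j) ≡ ∑∑ a + ∑∑ b
∑∑-distrib-+ a b = trans (sum-cong-≗ (λ i → ∑-distrib-+ (a i) (b i)))
                         (∑-distrib-+ (λ i → sum (a i)) (λ i → sum (b i)))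

∑∑-transpose : (b : Fin n → Fin n → ℕ) → ∑∑ (λ i j → b j i) ≡ ∑∑ b
∑∑-transpose b = ∑-comm (λ i j → b j i)

avoiding : Fin n → (Fin n → Fin n → ℕ) → Fin n → Fin n → ℕ
avoiding u b i j = 𝟙 (not (does (i ≟ u)) ∧ not (does (j ≟ u))) * b i j

∑∑-split : (b : Fin n → Fin n → ℕ) (u : Fin n) →
  (∀ i j → b i j ≡ b j i) → b u u ≡ 0 →
  ∑∑ b ≡ 2 * sum (b u) + ∑∑ (avoiding u b)
∑∑-split {n} b u symmetric loopless = begin
  ∑∑ b
    ≡⟨ sum-cong-≗ (λ i → sum-cong-≗ (pointwise i)) ⟩
  ∑∑ (λ i j → atᵤ i j + atᵤ j i + off i j)
    ≡⟨ ∑∑-distrib-+ _ off ⟩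
  ∑∑ (λ i j → atᵤ i j + atᵤ j i) + ∑∑ off
    ≡⟨ cong (_+ ∑∑ off) (∑∑-distrib-+ atᵤ _) ⟩
  ∑∑ atᵤ + ∑∑ (λ i j → atᵤ j i) + ∑∑ off
    ≡⟨ cong (λ t → ∑∑ atᵤ + t + ∑∑ off) (∑∑-transpose atᵤ) ⟩
  ∑∑ atᵤ + ∑∑ atᵤ + ∑∑ off
    ≡⟨ cong (λ t → t + t + ∑∑ off) rowᵤ ⟩
  sum (b u) + sum (b u) + ∑∑ off
    ≡⟨ cong (λ t → sum (b u) + t + ∑∑ off) (+-identityʳ (sum (b u))) ⟨
  2 * sum (b u) + ∑∑ off ∎
  where
  open ≡-Reasoning
  atᵤ off : Fin n → Fin n → ℕ
  atᵤ i j = 𝟙 (does (i ≟ u)) * b u j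
  off = avoiding u b

  pointwise : ∀ i j → b i j ≡ atᵤ i j + atᵤ j i + off i j
  pointwise i j with i ≟ u | j ≟ u
  ... | yes refl | yes refl rewrite loopless = refl
  ... | yes refl | no _ = sym (trans (+-identityʳ _) (trans (+-identityʳ _) (+-identityʳ _)))
  ... | no _ | yes refl = trans (symmetric i u) (sym (trans (+-identityʳ _) (+-identityʳ _)))
  ... | no _ | no _ = sym (+-identityʳ _)

  rowᵤ : ∑∑ atᵤ ≡ sum (b u)
  rowᵤ = trans (sum-cong-≗ (λ i → sym (*-distribˡ-sum {n} (𝟙 (does (i ≟ u))) (b u))))
               (sum-δ (λ _ → sum (b u)) u)

-- Subsets

∣p∪q∣≤∣p∣+∣q∣ : ∀ (p q : Subset n) → ∣ p ∪ q ∣ ≤ ∣ p ∣ + ∣ q ∣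
∣p∪q∣≤∣p∣+∣q∣ [] [] = z≤n
∣p∪q∣≤∣p∣+∣q∣ (true ∷ p) (true ∷ q) =
  s≤s (≤-trans (∣p∪q∣≤∣p∣+∣q∣ p q) (+-monoʳ-≤ ∣ p ∣ (n≤1+n ∣ q ∣)))
∣p∪q∣≤∣p∣+∣q∣ (true ∷ p) (false ∷ q) = s≤s (∣p∪q∣≤∣p∣+∣q∣ p q)
∣p∪q∣≤∣p∣+∣q∣ (false ∷ p) (true ∷ q) rewrite +-suc ∣ p ∣ ∣ q ∣ = s≤s (∣p∪q∣≤∣p∣+∣q∣ p q)
∣p∪q∣≤∣p∣+∣q∣ (false ∷ p) (false ∷ q) = ∣p∪q∣≤∣p∣+∣q∣ p q

there-∈-∉ : ∀ {s t} {p q : Subset n} →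
  ∃[ z ] (z ∈ p × z ∉ q) → ∃[ z ] (z ∈ s ∷ p × z ∉ t ∷ q)
there-∈-∉ (z , z∈p , z∉q) = suc z , there z∈p , z∉q ∘ drop-there

∃-∈-∉ : ∀ {p q : Subset n} → ∣ q ∣ < ∣ p ∣ → ∃[ z ] (z ∈ p × z ∉ q)
∃-∈-∉ {p = true ∷ p} {false ∷ q} _ = zero , here , λ ()
∃-∈-∉ {p = true ∷ p} {true ∷ q} (s≤s q<p) = there-∈-∉ (∃-∈-∉ q<p)
∃-∈-∉ {p = false ∷ p} {true ∷ q} q<p = there-∈-∉ (∃-∈-∉ (≤-trans (n≤1+n _) q<p))
∃-∈-∉ {p = false ∷ p} {false ∷ q} q<p = there-∈-∉ (∃-∈-∉ q<p)

∃-∈-avoiding₂ : ∀ (p : Subset n) x y → 3 ≤ ∣ p ∣ → ∃[ z ] (z ∈ p × z ≢ x × z ≢ y)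
∃-∈-avoiding₂ p x y 3≤∣p∣ = avoid (∃-∈-∉ ∣xy∣<∣p∣)
  where
  ∣xy∣<∣p∣ : ∣ ⁅ x ⁆ ∪ ⁅ y ⁆ ∣ < ∣ p ∣
  ∣xy∣<∣p∣ = <-≤-trans (s≤s (begin
    ∣ ⁅ x ⁆ ∪ ⁅ y ⁆ ∣      ≤⟨ ∣p∪q∣≤∣p∣+∣q∣ ⁅ x ⁆ ⁅ y ⁆ ⟩
    ∣ ⁅ x ⁆ ∣ + ∣ ⁅ y ⁆ ∣  ≡⟨ cong₂ _+_ (∣⁅x⁆∣≡1 x) (∣⁅x⁆∣≡1 y) ⟩
    2                      ∎)) 3≤∣p∣
    where open ≤-Reasoning
  avoid : ∃[ z ] (z ∈ p × z ∉ ⁅ x ⁆ ∪ ⁅ y ⁆) → ∃[ z ] (z ∈ p × z ≢ x × z ≢ y)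
  avoid (z , z∈p , z∉xy) =
    z , z∈p , (λ { refl → z∉xy (x∈p∪q⁺ (inj₁ (x∈⁅x⁆ z))) })
            , (λ { refl → z∉xy (x∈p∪q⁺ (inj₂ (x∈⁅x⁆ z))) })

-- Fill edges

ordered : Fin n → Fin n → Bool
ordered i j = toℕ i <ᵇ toℕ j

𝟙-split-by-order : (b : Fin n → Fin n → Bool) →
  (∀ i j → b i j ≡ b j i) → (∀ i → b i i ≡ false) →
  ∀ i j → 𝟙 (b i j) ≡ 𝟙 (ordered i j ∧ b i j) + 𝟙 (ordered j i ∧ b j i)
𝟙-split-by-order b symmetric irreflexive i j with <-cmp (toℕ i) (toℕ j)
... | tri< i<j _ j≮i
  rewrite dec-true (toℕ i <? toℕ j) i<j | dec-false (toℕ j <? toℕ i) j≮i = sym (+-identityʳ _)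
... | tri> i≮j _ j<i
  rewrite dec-false (toℕ i <? toℕ j) i≮j | dec-true (toℕ j <? toℕ i) j<i = cong 𝟙 (symmetric i j)
... | tri≈ i≮j i≡j _
  rewrite toℕ-injective i≡j | dec-false (toℕ j <? toℕ j) i≮j | irreflexive j = refl

fillᵇ : Graph n → Graph n → Fin n → Fin n → Bool
fillᵇ G X i j = adj X i j ∧ not (adj G i j)

fillᵇ-sym : (G X : Graph n) → ∀ i j → fillᵇ G X i j ≡ fillᵇ G X j i
fillᵇ-sym G X i j rewrite Graph.sym X i j | Graph.sym G i j = refl

fillᵇ-irrefl : (G X : Graph n) → ∀ i → fillᵇ G X i i ≡ false
fillᵇ-irrefl G X i rewrite irrefl X i = refl

orderedFill : Graph n → Graph n → ℕ
orderedFill G X = ∑∑ (λ i j → 𝟙 (fillᵇ G X i j))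

orderedFill-split : (G X : Graph n) (u : Fin n) →
  orderedFill G X ≡ 2 * ∑[ j < n ] 𝟙 (fillᵇ G X u j) + ∑∑ (avoiding u (λ i j → 𝟙 (fillᵇ G X i j)))
orderedFill-split G X u =
  ∑∑-split _ u (λ i j → cong 𝟙 (fillᵇ-sym G X i j)) (cong 𝟙 (fillᵇ-irrefl G X u))

orderedFill≡2*fillCount : (G X : Graph n) → orderedFill G X ≡ 2 * fillCount G X
orderedFill≡2*fillCount {n} G X = begin
  ∑∑ (λ i j → 𝟙 (fillᵇ G X i j))
    ≡⟨ sum-cong-≗ (λ i → sum-cong-≗ (𝟙-split-by-order _ (fillᵇ-sym G X) (fillᵇ-irrefl G X) i)) ⟩
  ∑∑ (λ i j → pair i j + pair j i)  ≡⟨ ∑∑-distrib-+ pair _ ⟩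
  ∑∑ pair + ∑∑ (λ i j → pair j i)   ≡⟨ cong (∑∑ pair +_) (∑∑-transpose pair) ⟩
  ∑∑ pair + ∑∑ pair                 ≡⟨ cong (∑∑ pair +_) (+-identityʳ (∑∑ pair)) ⟨
  2 * ∑∑ pair                       ≡⟨ cong (2 *_) fillCount≡∑∑pair ⟨
  2 * fillCount G X                 ∎
  where
  open ≡-Reasoning
  pair : Fin n → Fin n → ℕ
  pair i j = 𝟙 (ordered i j ∧ fillᵇ G X i j)
  fillCount≡∑∑pair : fillCount G X ≡ ∑∑ pair
  fillCount≡∑∑pair = trans (sum-allFin (λ i → List.sum (map (pair i) (allFin n))))
                           (sum-cong-≗ (λ i → sum-allFin (pair i)))

fillCount-<-orderedFill : (G X Y : Graph n) →
  orderedFill G X < orderedFill G Y → fillCount G X < fillCount G Y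
fillCount-<-orderedFill G X Y fill< = *-cancelˡ-< 2 _ _
  (subst₂ _<_ (orderedFill≡2*fillCount G X) (orderedFill≡2*fillCount G Y) fill<)

nonNeighbour : Graph n → Fin n → Fin n → ℕ
nonNeighbour X u j = 𝟙 (not (does (j ≟ u)) ∧ not (adj X u j))

-- Two components

module _ {G : Graph n} where

  Reachable-trans : ∀ {x y z} → Reachable G x y → Reachable G y z → Reachable G x z
  Reachable-trans here q = q
  Reachable-trans (step e p) q = step e (Reachable-trans p q)

  Reachable-sym : ∀ {x y} → Reachable G x y → Reachable G y x
  Reachable-sym here = here
  Reachable-sym (step {x} {y} e p) =
    Reachable-trans (Reachable-sym p) (step (trans (Graph.sym G y x) e) here)

module Components {G : Graph n} {u v : Fin n} (components : TwoComponents G u v) where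

  u≢v : u ≢ v
  u≢v refl = proj₁ components here

  inCᵤ : Fin n → Bool
  inCᵤ x with proj₂ components x
  ... | inj₁ _ = true
  ... | inj₂ _ = false

  inCᵤ-reach : ∀ {x} → Reachable G u x → inCᵤ x ≡ true
  inCᵤ-reach {x} u⇝x with proj₂ components x
  ... | inj₁ _ = refl
  ... | inj₂ v⇝x = contradiction (Reachable-trans u⇝x (Reachable-sym v⇝x)) (proj₁ components)

  inCᵥ-reach : ∀ {x} → Reachable G v x → inCᵤ x ≡ false
  inCᵥ-reach {x} v⇝x with proj₂ components x
  ... | inj₁ u⇝x = contradiction (Reachable-trans u⇝x (Reachable-sym v⇝x)) (proj₁ components)
  ... | inj₂ _ = refl

  inCᵤ-edge : ∀ {x y} → Edge G x y → inCᵤ x ≡ inCᵤ y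
  inCᵤ-edge {x} e with proj₂ components x
  ... | inj₁ u⇝x = sym (inCᵤ-reach (Reachable-trans u⇝x (step e here)))
  ... | inj₂ v⇝x = sym (inCᵥ-reach (Reachable-trans v⇝x (step e here)))

  crossing : Fin n → Fin n → Bool
  crossing x y = inCᵤ x xor inCᵤ y

  crossing-irrefl : ∀ x → crossing x x ≡ false
  crossing-irrefl x = xor-same (inCᵤ x)

  crossing⇒≢ : ∀ {x y} → crossing x y ≡ true → x ≢ y
  crossing⇒≢ {x} c refl with () ← trans (sym c) (crossing-irrefl x)

  crossing⇒NonEdge : ∀ {x y} → crossing x y ≡ true → NonEdge G x y
  crossing⇒NonEdge {x} {y} c with adj G x y in e
  ... | false = refl
  ... | true with () ← trans (sym c) (trans (cong (_xor inCᵤ y) (inCᵤ-edge e)) (crossing-irrefl y))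

  crossing-sym : ∀ x y → crossing x y ≡ crossing y x
  crossing-sym x y with inCᵤ x | inCᵤ y
  ... | true | true = refl
  ... | true | false = refl
  ... | false | true = refl
  ... | false | false = refl

  crossing-through : ∀ {x y z} → crossing x y ≡ true → crossing x z ≡ false → crossing y z ≡ true
  crossing-through {x} {y} {z} with inCᵤ x | inCᵤ y | inCᵤ z
  ... | true | false | true = λ _ _ → refl
  ... | false | true | false = λ _ _ → refl
  ... | true | true | _ = λ ()
  ... | false | false | _ = λ ()
  ... | true | false | false = λ _ ()
  ... | false | true | true = λ _ ()

-- A universal vertex

module _ {X : Graph n} {w : Fin n} (universal : ∀ y → y ≢ w → Edge X w y) where

  private
    loop : Edge X w w → ⊥
    loop e with () ← trans (sym e) (irrefl X w)

    nonEdgeˡ : ∀ {y} → NonEdge X w y → y ≡ w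
    nonEdgeˡ {y} ne with y ≟ w
    ... | yes y≡w = y≡w
    ... | no y≢w with () ← trans (sym (universal y y≢w)) ne

    nonEdgeʳ : ∀ {y} → NonEdge X y w → y ≡ w
    nonEdgeʳ {y} ne = nonEdgeˡ (trans (Graph.sym X w y) ne)

  InducesP4-transfer : (Y : Graph n) → (∀ x y → x ≢ w → y ≢ w → adj X x y ≡ adj Y x y) →
    ∀ {A} → InducesP4 X A → InducesP4 Y A
  InducesP4-transfer Y agree (size , a , b , c , d , members , ab , bc , cd , ac , bd , ad) =
    size , a , b , c , d , members ,
    move a≢w b≢w ab , move b≢w c≢w bc , move c≢w d≢w cd ,
    move a≢w c≢w ac , move b≢w d≢w bd , move a≢w d≢w ad
    where
    move : ∀ {x y t} → x ≢ w → y ≢ w → adj X x y ≡ t → adj Y x y ≡ t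
    move {x} {y} x≢w y≢w e = trans (sym (agree x y x≢w y≢w)) e
    a≢w : a ≢ w
    a≢w refl with refl ← nonEdgeˡ ac with refl ← nonEdgeˡ ad = loop cd
    b≢w : b ≢ w
    b≢w refl with refl ← nonEdgeˡ bd with refl ← nonEdgeʳ ad = loop ab
    c≢w : c ≢ w
    c≢w refl with refl ← nonEdgeʳ ac with refl ← nonEdgeˡ ad = loop cd
    d≢w : d ≢ w
    d≢w refl with refl ← nonEdgeʳ bd with refl ← nonEdgeʳ ad = loop ab

module _ (G : Graph n) (u : Fin n) where

  universalAdj : Fin n → Fin n → Bool
  universalAdj x y with x ≟ u | y ≟ u
  ... | yes _ | yes _ = false
  ... | yes _ | no _ = true
  ... | no _ | yes _ = true
  ... | no _ | no _ = adj G x y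

  universalAdj-sym : ∀ x y → universalAdj x y ≡ universalAdj y x
  universalAdj-sym x y with x ≟ u | y ≟ u
  ... | yes _ | yes _ = refl
  ... | yes _ | no _ = refl
  ... | no _ | yes _ = refl
  ... | no _ | no _ = Graph.sym G x y

  universalAdj-irrefl : ∀ x → universalAdj x x ≡ false
  universalAdj-irrefl x with x ≟ u
  ... | yes _ = refl
  ... | no _ = irrefl G x

makeUniversal : Graph n → Fin n → Graph n
makeUniversal G u = record
  { adj = universalAdj G u ; sym = universalAdj-sym G u ; irrefl = universalAdj-irrefl G u }

module _ {G : Graph n} {u : Fin n} where

  private
    H′ = makeUniversal G u

  makeUniversal-⊇ : ∀ x y → Edge G x y → Edge H′ x y
  makeUniversal-⊇ x y e with x ≟ u | y ≟ u
  ... | yes refl | yes refl with () ← trans (sym e) (irrefl G u)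
  ... | yes _ | no _ = refl
  ... | no _ | yes _ = refl
  ... | no _ | no _ = e

  makeUniversal-universal : ∀ y → y ≢ u → Edge H′ u y
  makeUniversal-universal y y≢u with u ≟ u | y ≟ u
  ... | no u≢u | _ = contradiction refl u≢u
  ... | yes _ | yes y≡u = contradiction y≡u y≢u
  ... | yes _ | no _ = refl

  makeUniversal-agrees : ∀ x y → x ≢ u → y ≢ u → adj H′ x y ≡ adj G x y
  makeUniversal-agrees x y x≢u y≢u with x ≟ u | y ≟ u
  ... | yes x≡u | _ = contradiction x≡u x≢u
  ... | no _ | yes y≡u = contradiction y≡u y≢u
  ... | no _ | no _ = refl

  P4Sparse-makeUniversal : P4Sparse G → P4Sparse H′
  P4Sparse-makeUniversal sparse X A B size A⊆X B⊆X P4ᴬ P4ᴮ =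
    sparse X A B size A⊆X B⊆X (transfer P4ᴬ) (transfer P4ᴮ)
    where
    transfer : ∀ {C} → InducesP4 H′ C → InducesP4 G C
    transfer = InducesP4-transfer {X = H′} makeUniversal-universal G makeUniversal-agrees

  orderedFill-makeUniversal : orderedFill G H′ ≡ 2 * sum (nonNeighbour G u)
  orderedFill-makeUniversal = begin
    orderedFill G H′
      ≡⟨ orderedFill-split G H′ u ⟩
    2 * ∑[ j < n ] 𝟙 (fillᵇ G H′ u j) + ∑∑ (avoiding u (λ i j → 𝟙 (fillᵇ G H′ i j)))
      ≡⟨ cong₂ (λ s t → 2 * s + t) (sum-cong-≗ row) (sum-zero (λ i → sum-zero (off i))) ⟩
    2 * sum (nonNeighbour G u) + 0
      ≡⟨ +-identityʳ _ ⟩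
    2 * sum (nonNeighbour G u) ∎
    where
    open ≡-Reasoning
    row : ∀ j → 𝟙 (fillᵇ G H′ u j) ≡ nonNeighbour G u j
    row j with u ≟ u | j ≟ u
    ... | no u≢u | _ = contradiction refl u≢u
    ... | yes _ | yes _ = refl
    ... | yes _ | no _ = refl
    off : ∀ i j → avoiding u (λ i j → 𝟙 (fillᵇ G H′ i j)) i j ≡ 0
    off i j with i ≟ u | j ≟ u
    ... | yes _ | _ = refl
    ... | no _ | yes _ = refl
    ... | no _ | no _ rewrite ∧-inverseʳ (adj G i j) = refl

-- Thick spiders

module ThickSpiderFill {G H : Graph n} {u v : Fin n}
  (components : TwoComponents G u v)
  (G⊆H : ∀ x y → Edge G x y → Edge H x y) (uv∈H : Edge H u v)
  {S K R : Subset n} (partition : IsPartition3 S K R)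
  (S-independent : ∀ x y → x ∈ S → y ∈ S → NonEdge H x y)
  (K-clique : ∀ x y → x ∈ K → y ∈ K → x ≢ y → Edge H x y)
  (R-K-adjacent : ∀ r k → r ∈ R → k ∈ K → Edge H r k)
  (R-S-nonadjacent : ∀ r s → r ∈ R → s ∈ S → NonEdge H r s)
  {f : Fin n → Fin n} (f-K : ∀ s → s ∈ S → f s ∈ K)
  (f-injective : ∀ s t → s ∈ S → t ∈ S → f s ≡ f t → s ≡ t)
  (f-neighbourhood : ∀ s k → s ∈ S → k ∈ K → (Edge H s k ⇔ k ≢ f s))
  (3≤∣K∣ : 3 ≤ ∣ K ∣) (u∈R : u ∈ R) (v∈R : v ∈ R)
  {xᵤ xᵥ : Fin n} (xᵤ∈S∪K : xᵤ ∈ S ⊎ xᵤ ∈ K) (u⇝xᵤ : Reachable G u xᵤ)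
  (xᵥ∈S∪K : xᵥ ∈ S ⊎ xᵥ ∈ K) (v⇝xᵥ : Reachable G v xᵥ)
  where

  open Components components

  ∈S⇒∉K : ∀ {x} → x ∈ S → x ∉ K
  ∈S⇒∉K {x} x∈S with partition x
  ... | inj₁ (_ , x∉K , _) = x∉K
  ... | inj₂ (inj₁ (x∉S , _)) = contradiction x∈S x∉S
  ... | inj₂ (inj₂ (x∉S , _)) = contradiction x∈S x∉S

  ∈R⇒∉S : ∀ {x} → x ∈ R → x ∉ S
  ∈R⇒∉S {x} x∈R with partition x
  ... | inj₁ (_ , _ , x∉R) = contradiction x∈R x∉R
  ... | inj₂ (inj₁ (x∉S , _)) = x∉S
  ... | inj₂ (inj₂ (x∉S , _)) = x∉S

  ∈R⇒∉K : ∀ {x} → x ∈ R → x ∉ K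
  ∈R⇒∉K {x} x∈R with partition x
  ... | inj₁ (_ , x∉K , _) = x∉K
  ... | inj₂ (inj₁ (_ , _ , x∉R)) = contradiction x∈R x∉R
  ... | inj₂ (inj₂ (_ , x∉K , _)) = x∉K

  ∉K⇒∈S⊎∈R : ∀ {x} → x ∉ K → x ∈ S ⊎ x ∈ R
  ∉K⇒∈S⊎∈R {x} x∉K with partition x
  ... | inj₁ (x∈S , _) = inj₁ x∈S
  ... | inj₂ (inj₁ (_ , x∈K , _)) = contradiction x∈K x∉K
  ... | inj₂ (inj₂ (_ , _ , x∈R)) = inj₂ x∈R

  ∈K⇒≢u : ∀ {x} → x ∈ K → x ≢ u
  ∈K⇒≢u x∈K refl = ∈R⇒∉K u∈R x∈K

  ∈K⇒≢v : ∀ {x} → x ∈ K → x ≢ v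
  ∈K⇒≢v x∈K refl = ∈R⇒∉K v∈R x∈K

  ∈S⇒≢u : ∀ {x} → x ∈ S → x ≢ u
  ∈S⇒≢u x∈S refl = ∈R⇒∉S u∈R x∈S

  S-neighbour∈K : ∀ {x y} → x ∈ S → Edge H x y → y ∈ K
  S-neighbour∈K {x} {y} x∈S xy with y ∈? K
  ... | yes y∈K = y∈K
  ... | no y∉K with ∉K⇒∈S⊎∈R y∉K
  ...   | inj₁ y∈S with () ← trans (sym xy) (S-independent x y x∈S y∈S)
  ...   | inj₂ y∈R with () ← trans (sym xy) (trans (Graph.sym H x y) (R-S-nonadjacent y x y∈R x∈S))

  S-K-edge : ∀ {s k} → s ∈ S → k ∈ K → k ≢ f s → Edge H s k
  S-K-edge {s} {k} s∈S k∈K = Equivalence.from (f-neighbourhood s k s∈S k∈K)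

  K-vertex-beside : ∀ {w x} → w ∈ R → x ∈ S ⊎ x ∈ K → Reachable G w x →
    ∃[ k ] (k ∈ K × inCᵤ k ≡ inCᵤ x)
  K-vertex-beside w∈R (inj₂ x∈K) _ = _ , x∈K , refl
  K-vertex-beside {x = x} w∈R (inj₁ x∈S) w⇝x with Reachable-sym w⇝x
  ... | here = contradiction x∈S (∈R⇒∉S w∈R)
  ... | step {y = y} xy _ = y , S-neighbour∈K x∈S (G⊆H x y xy) , sym (inCᵤ-edge xy)

  crossing-into-K : ∀ x → ∃[ k ] (k ∈ K × crossing x k ≡ true)
  crossing-into-K x
    with K-vertex-beside u∈R xᵤ∈S∪K u⇝xᵤ | K-vertex-beside v∈R xᵥ∈S∪K v⇝xᵥ | inCᵤ x
  ... | kᵤ , kᵤ∈K , kᵤ-side | kᵥ , kᵥ∈K , kᵥ-side | true =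
    kᵥ , kᵥ∈K , cong not (trans kᵥ-side (inCᵥ-reach v⇝xᵥ))
  ... | kᵤ , kᵤ∈K , kᵤ-side | kᵥ , kᵥ∈K , kᵥ-side | false =
    kᵤ , kᵤ∈K , trans kᵤ-side (inCᵤ-reach u⇝xᵤ)

  crossEdge fillEdge toK inK : Fin n → Fin n → ℕ
  crossEdge = avoiding u (λ i j → 𝟙 (crossing i j ∧ adj H i j))
  fillEdge = avoiding u (λ i j → 𝟙 (fillᵇ G H i j))
  toK i j = 𝟙 (not (does (i ∈? K)) ∧ does (j ∈? K)) * crossEdge i j
  inK i j = 𝟙 (does (i ∈? K) ∧ does (j ∈? K)) * crossEdge i j

  crossEdge-sym : ∀ i j → crossEdge i j ≡ crossEdge j i
  crossEdge-sym i j rewrite crossing-sym i j | Graph.sym H i j with i ≟ u | j ≟ u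
  ... | yes _ | yes _ = refl
  ... | yes _ | no _ = refl
  ... | no _ | yes _ = refl
  ... | no _ | no _ = refl

  crossEdge≤fillEdge : ∀ i j → crossEdge i j ≤ fillEdge i j
  crossEdge≤fillEdge i j = *-monoʳ-≤ (𝟙 (not (does (i ≟ u)) ∧ not (does (j ≟ u)))) cross≤fill
    where
    cross≤fill : 𝟙 (crossing i j ∧ adj H i j) ≤ 𝟙 (fillᵇ G H i j)
    cross≤fill with crossing i j in c | adj H i j
    ... | false | _ = z≤n
    ... | true | false = z≤n
    ... | true | true rewrite crossing⇒NonEdge c = ≤-refl

  crossEdge≡1 : ∀ {i j} → i ≢ u → j ≢ u → crossing i j ≡ true → Edge H i j →
    crossEdge i j ≡ 1
  crossEdge≡1 {i} {j} i≢u j≢u c e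
    rewrite dec-false (i ≟ u) i≢u | dec-false (j ≟ u) j≢u | c | e = refl

  toK+toKᵀ+inK≤fillEdge : ∀ i j → toK i j + toK j i + inK i j ≤ fillEdge i j
  toK+toKᵀ+inK≤fillEdge i j rewrite crossEdge-sym j i with i ∈? K | j ∈? K
  ... | yes _ | yes _ = ≤-trans (≤-reflexive (*-identityˡ _)) (crossEdge≤fillEdge i j)
  ... | yes _ | no _ =
    ≤-trans (≤-reflexive (trans (+-identityʳ _) (*-identityˡ _))) (crossEdge≤fillEdge i j)
  ... | no _ | yes _ =
    ≤-trans (≤-reflexive (trans (+-identityʳ _) (trans (+-identityʳ _) (*-identityˡ _))))
            (crossEdge≤fillEdge i j)
  ... | no _ | no _ = z≤n

  -- Ordered pairs count every edge twice: a cross edge from j into K pays 2 to j, and a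
  -- cross edge inside K at f j pays 1 to j.
  supply : Fin n → ℕ
  supply j = 2 * sum (toK j) + 𝟙 (does (j ∈? S)) * sum (inK (f j))

  sum-supply≤fillEdges : sum supply ≤ ∑∑ fillEdge
  sum-supply≤fillEdges = begin
    sum supply
      ≡⟨ ∑-distrib-+ (λ j → 2 * sum (toK j)) (λ j → 𝟙 (does (j ∈? S)) * sum (inK (f j))) ⟩
    ∑[ j < n ] (2 * sum (toK j)) + ∑[ j < n ] (𝟙 (does (j ∈? S)) * sum (inK (f j)))
      ≤⟨ +-mono-≤ (≤-reflexive (sym (*-distribˡ-sum 2 (λ j → sum (toK j)))))
                  (sum-reindex-≤ (_∈? S) f (λ k → sum (inK k)) (f-injective _ _)) ⟩
    2 * ∑∑ toK + ∑∑ inK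
      ≡⟨ cong (λ t → ∑∑ toK + t + ∑∑ inK) (trans (*-identityˡ (∑∑ toK)) (sym (∑∑-transpose toK))) ⟩
    ∑∑ toK + ∑∑ (λ i j → toK j i) + ∑∑ inK
      ≡⟨ trans (∑∑-distrib-+ _ inK) (cong (_+ ∑∑ inK) (∑∑-distrib-+ toK _)) ⟨
    ∑∑ (λ i j → toK i j + toK j i + inK i j)
      ≤⟨ ∑∑-mono-≤ toK+toKᵀ+inK≤fillEdge ⟩
    ∑∑ fillEdge ∎
    where open ≤-Reasoning

  2≤supply-toK : ∀ {j k} → j ∉ K → j ≢ u → k ∈ K → crossing j k ≡ true → Edge H j k →
    2 ≤ supply j
  2≤supply-toK {j} {k} j∉K j≢u k∈K c e = begin
    2                ≡⟨ cong (2 *_) toK≡1 ⟨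
    2 * toK j k      ≤⟨ *-monoʳ-≤ 2 (term≤sum (toK j) k) ⟩
    2 * sum (toK j)  ≤⟨ m≤m+n _ _ ⟩
    supply j         ∎
    where
    open ≤-Reasoning
    toK≡1 : toK j k ≡ 1
    toK≡1 rewrite dec-false (j ∈? K) j∉K | dec-true (k ∈? K) k∈K
                | crossEdge≡1 j≢u (∈K⇒≢u k∈K) c e = refl

  2≤supply-inK : ∀ {j a c} → j ∈ S → a ∈ K → c ∈ K → a ≢ c →
    crossing (f j) a ≡ true → crossing (f j) c ≡ true → 2 ≤ supply j
  2≤supply-inK {j} {a} {c} j∈S a∈K c∈K a≢c ca cc = begin
    2                                    ≡⟨ cong₂ _+_ (inK≡1 a∈K ca) (inK≡1 c∈K cc) ⟨
    inK (f j) a + inK (f j) c            ≤⟨ two-terms≤sum (inK (f j)) a≢c ⟩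
    sum (inK (f j))                      ≡⟨ *-identityˡ _ ⟨
    1 * sum (inK (f j))                  ≡⟨ cong (λ b → 𝟙 b * sum (inK (f j))) (dec-true (j ∈? S) j∈S) ⟨
    𝟙 (does (j ∈? S)) * sum (inK (f j))  ≤⟨ m≤n+m _ _ ⟩
    supply j                             ∎
    where
    open ≤-Reasoning
    fj∈K = f-K j j∈S
    inK≡1 : ∀ {k} → k ∈ K → crossing (f j) k ≡ true → inK (f j) k ≡ 1
    inK≡1 {k} k∈K ck
      rewrite dec-true (f j ∈? K) fj∈K | dec-true (k ∈? K) k∈K
            | crossEdge≡1 (∈K⇒≢u fj∈K) (∈K⇒≢u k∈K) ck
                          (K-clique (f j) k fj∈K k∈K (crossing⇒≢ ck)) = refl

  2≤supply-S : ∀ {j} → j ∈ S → 2 ≤ supply j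
  2≤supply-S {j} j∈S with crossing j (f j) in cf
  ... | false with crossing-into-K j
  ...   | k , k∈K , ck = 2≤supply-toK (∈S⇒∉K j∈S) (∈S⇒≢u j∈S) k∈K ck (S-K-edge j∈S k∈K k≢fj)
    where
    k≢fj : k ≢ f j
    k≢fj refl with () ← trans (sym ck) cf
  2≤supply-S {j} j∈S | true with ∃-∈-avoiding₂ K (f j) (f j) 3≤∣K∣
  ... | a , a∈K , a≢fj , _ with ∃-∈-avoiding₂ K (f j) a 3≤∣K∣
  ...   | c , c∈K , c≢fj , c≢a with crossing j a in ca | crossing j c in cc
  ...     | true | _ =
    2≤supply-toK (∈S⇒∉K j∈S) (∈S⇒≢u j∈S) a∈K ca (S-K-edge j∈S a∈K a≢fj)
  ...     | false | true =
    2≤supply-toK (∈S⇒∉K j∈S) (∈S⇒≢u j∈S) c∈K cc (S-K-edge j∈S c∈K c≢fj)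
  ...     | false | false =
    2≤supply-inK j∈S a∈K c∈K (c≢a ∘ sym) (crossing-through cf ca) (crossing-through cf cc)

  2≤supply : ∀ {j} → j ∉ K → j ≢ u → 2 ≤ supply j
  2≤supply j∉K j≢u with ∉K⇒∈S⊎∈R j∉K
  ... | inj₁ j∈S = 2≤supply-S j∈S
  ... | inj₂ j∈R with crossing-into-K _
  ...   | k , k∈K , c = 2≤supply-toK j∉K j≢u k∈K c (R-K-adjacent _ k j∈R k∈K)

  -- v is joined to u yet charged, which yields the strict inequality.
  demand : Fin n → ℕ
  demand j = 2 * nonNeighbour H u j + 𝟙 (does (j ≟ v))

  demand≤2 : ∀ j → demand j ≤ 2
  demand≤2 j with j ≟ v
  ... | yes refl rewrite uv∈H | ∧-zeroʳ (not (does (v ≟ u))) = s≤s z≤n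
  ... | no _ = ≤-trans (≤-reflexive (+-identityʳ _))
                       (*-monoʳ-≤ 2 (𝟙≤1 (not (does (j ≟ u)) ∧ not (adj H u j))))

  demand-K : ∀ {j} → j ∈ K → demand j ≡ 0
  demand-K {j} j∈K rewrite R-K-adjacent u j u∈R j∈K | ∧-zeroʳ (not (does (j ≟ u)))
                         | dec-false (j ≟ v) (∈K⇒≢v j∈K) = refl

  demand-u : demand u ≡ 0
  demand-u rewrite dec-true (u ≟ u) refl | dec-false (u ≟ v) u≢v = refl

  demand≤supply : ∀ j → demand j ≤ supply j
  demand≤supply j = by-cases (j ∈? K) (j ≟ u)
    where
    by-cases : Dec (j ∈ K) → Dec (j ≡ u) → demand j ≤ supply j
    by-cases (yes j∈K) _ = ≤-trans (≤-reflexive (demand-K j∈K)) z≤n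
    by-cases (no _) (yes refl) = ≤-trans (≤-reflexive demand-u) z≤n
    by-cases (no j∉K) (no j≢u) = ≤-trans (demand≤2 j) (2≤supply j∉K j≢u)

  fillEdges-lower-bound : 2 * sum (nonNeighbour H u) + 1 ≤ ∑∑ fillEdge
  fillEdges-lower-bound = begin
    2 * sum (nonNeighbour H u) + 1
      ≡⟨ cong₂ _+_ (*-distribˡ-sum 2 (nonNeighbour H u)) (sym (sum-δ (λ _ → 1) v)) ⟩
    ∑[ j < n ] (2 * nonNeighbour H u j) + ∑[ j < n ] (𝟙 (does (j ≟ v)) * 1)
      ≡⟨ cong (∑[ j < n ] (2 * nonNeighbour H u j) +_) (sum-cong-≗ {n} (λ _ → *-identityʳ _)) ⟩
    ∑[ j < n ] (2 * nonNeighbour H u j) + ∑[ j < n ] 𝟙 (does (j ≟ v))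
      ≡⟨ ∑-distrib-+ (λ j → 2 * nonNeighbour H u j) _ ⟨
    sum demand
      ≤⟨ sum-mono-≤ demand≤supply ⟩
    sum supply
      ≤⟨ sum-supply≤fillEdges ⟩
    ∑∑ fillEdge ∎
    where open ≤-Reasoning

  nonNeighbourᴳ≤ : ∀ j → nonNeighbour G u j ≤ 𝟙 (fillᵇ G H u j) + nonNeighbour H u j
  nonNeighbourᴳ≤ j with adj H u j in uj∈H | adj G u j in uj∈G
  ... | true | _ = ≤-trans (𝟙-∧≤ʳ (not (does (j ≟ u))) _) (m≤m+n _ _)
  ... | false | false = ≤-refl
  ... | false | true with () ← trans (sym (G⊆H u j uj∈G)) uj∈H

  orderedFill-makeUniversal< : orderedFill G (makeUniversal G u) < orderedFill G H
  orderedFill-makeUniversal< = begin-strict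
    orderedFill G (makeUniversal G u)   ≡⟨ orderedFill-makeUniversal {G = G} ⟩
    2 * sum (nonNeighbour G u)          ≤⟨ *-monoʳ-≤ 2 (sum-mono-≤ nonNeighbourᴳ≤) ⟩
    2 * ∑[ j < n ] (atᵤ j + N j)        ≡⟨ cong (2 *_) (∑-distrib-+ atᵤ N) ⟩
    2 * (sum atᵤ + sum N)               ≡⟨ *-distribˡ-+ 2 (sum atᵤ) (sum N) ⟩
    2 * sum atᵤ + 2 * sum N             <⟨ +-monoʳ-< (2 * sum atᵤ) (m<m+n (2 * sum N) (s≤s z≤n)) ⟩
    2 * sum atᵤ + (2 * sum N + 1)       ≤⟨ +-monoʳ-≤ (2 * sum atᵤ) fillEdges-lower-bound ⟩
    2 * sum atᵤ + ∑∑ fillEdge           ≡⟨ orderedFill-split G H u ⟨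
    orderedFill G H                     ∎
    where
    open ≤-Reasoning
    atᵤ N : Fin n → ℕ
    atᵤ j = 𝟙 (fillᵇ G H u j)
    N = nonNeighbour H u

lemma9 : ∀ {n} (G H : Graph n) (u v : Fin n) →
    P4Sparse G → TwoComponents G u v →
    IsOptimalSolution G u v H →
    (S K R : Subset n) → IsThickSpiderPartition H S K R →
    u ∈ R → v ∈ R →
    ¬ ((∃[ x ] ((x ∈ S ⊎ x ∈ K) × Reachable G u x)) ×
       (∃[ y ] ((y ∈ S ⊎ y ∈ K) × Reachable G v y)))
lemma9 G H u v G-sparse components ((_ , G⊆H , uv∈H) , optimal) S K R
  ( partition , S-independent , K-clique , ∣S∣≡∣K∣ , 3≤∣S∣ , R-K-adjacent , R-S-nonadjacent
  , f , f-K , f-injective , _ , f-neighbourhood )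
  u∈R v∈R ((xᵤ , xᵤ∈S∪K , u⇝xᵤ) , (xᵥ , xᵥ∈S∪K , v⇝xᵥ)) =
  <⇒≱ (fillCount-<-orderedFill G H′ H Spider.orderedFill-makeUniversal<) (optimal H′ H′-solution)
  where
  module Spider = ThickSpiderFill {H = H} components G⊆H uv∈H partition
    S-independent K-clique R-K-adjacent R-S-nonadjacent f-K f-injective f-neighbourhood
    (subst (3 ≤_) ∣S∣≡∣K∣ 3≤∣S∣) u∈R v∈R xᵤ∈S∪K u⇝xᵤ xᵥ∈S∪K v⇝xᵥ
  H′ = makeUniversal G u
  H′-solution : IsSolution G u v H′
  H′-solution = P4Sparse-makeUniversal G-sparse , makeUniversal-⊇
              , makeUniversal-universal v (Components.u≢v components ∘ sym)
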